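{- Let $\mathcal{M}$ be an $M$-element matching of $K_N$ and let $e = uv$ be an edge of $K_N$ such that $\mathcal{M}' = \mathcal{M} \cup \{e\}$ is also a matching of $K_N$. Let $H = K_N \triangle \mathcal{M}$ and $H' = K_N \triangle \mathcal{M}'$, so $V(H') = V(H) \cup \{w_e\}$. For $c \in \mathbb{Z}_{\geq 0}^{V(H)}$ let $\alpha(c) \in \mathbb{Z}_{\ge 0}^{V(H')}$ be the sequence agreeing with $c$ on $V(H)$ and having value $1$ at $w_e$, and let $\beta(c) = \alpha(c) + \mathbf{e}_u - \mathbf{e}_{w_e}$. Let $\mathscr{B} = \{\beta(c) : c \in \mathfrak{D}(H)\}$. For $c \in \mathfrak{D}(H)$ define \[ \gamma(c) = \begin{cases} \alpha(c) + \mathbf{e}_v - \mathbf{e}_{w_e} & \text{if } \alpha(c) + \mathbf{e}_v - \mathbf{e}_{w_e} \notin \mathscr{B},\\ \alpha(c) - \mathbf{e}_u + \mathbf{e}_{w_e} & \text{otherwise.}\end{cases} \] Then for every $c \in \mathfrak{D}(H)$ we have $\gamma(c) \in \mathfrak{D}(H')$, and $\gamma$ is injective on $\mathfrak{D}(H)$.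
   Context: For a graph $G$ and a set $F$ of edges of $G$, $G \triangle F$ is the graph obtained from $G$ by adding, for each edge $e = xy \in F$, a new vertex $w_e$ together with the edges $xw_e$ and $yw_e$. For a simple graph $H$ on a finite vertex set $V$ with $|V| = n$, let $\overline{V} = \{\bar x : x \in V\}$ be a disjoint copy of $V$ and let $D(H)$ be the bipartite graph on $V \sqcup \overline{V}$ with edges $\{x,\bar x\}$ for every $x\in V$, and $\{x,\bar y\}$, $\{y,\bar x\}$ for every edge $xy$ of $H$. Write $\mathcal{N}_{D(H)}(x)$ for the set of neighbors of $x$ in $D(H)$. A sequence $c = (c_x)_{x \in V} \in \mathbb{Z}_{\geq 0}^V$ is $D(H)$-draconian if $\sum_{x\in V} c_x = n-1$ and for every nonempty $S \subseteq V$, $\sum_{x \in S} c_x < \bigl|\bigcup_{x \in S}\mathcal{N}_{D(H)}(x)\bigr|$. $\mathfrak{D}(H)$ denotes the set of $D(H)$-draconian sequences. $\mathbf{e}_x$ denotes the standard basis vector indexed by vertex $x$. -}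

module Defs where

open import Data.Nat using (ℕ; zero; suc; _+_; _∸_; _<_)
open import Data.Bool using (Bool; true; false; if_then_else_; _∧_; _∨_; not)
open import Data.Fin using (Fin; zero; suc; splitAt; _↑ʳ_; _≟_)
open import Data.Fin.Subset using (Subset; _∈_; ∣_∣; Nonempty)
open import Data.Vec using (tabulate; lookup)
open import Data.Vec.Functional using (Vector; _∷_)
open import Data.Product using (_×_; _,_; proj₁; proj₂; Σ; ∃)
open import Data.Sum using (_⊎_; inj₁; inj₂)
open import Relation.Nullary using (¬_)
open import Relation.Nullary.Decidable using (⌊_⌋)
open import Relation.Binary.PropositionalEquality using (_≡_; _≢_; _≗_)

sumF : ∀ {n} → (Fin n → ℕ) → ℕ
sumF {zero}  f = 0
sumF {suc n} f = f zero + sumF (λ i → f (suc i))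

sumOver : ∀ {n} → Subset n → (Fin n → ℕ) → ℕ
sumOver S c = sumF (λ x → if lookup S x then c x else 0)

anyF : ∀ {n} → (Fin n → Bool) → Bool
anyF {zero}  f = false
anyF {suc n} f = f zero ∨ anyF (λ i → f (suc i))

_==_ : ∀ {n} → Fin n → Fin n → Bool
x == y = ⌊ x ≟ y ⌋

-- D(H) is the bipartite graph on V ⊔ V̄ where x ∈ V is
-- adjacent to ȳ ∈ V̄ iff x = y or xy ∈ E(H).  All D(H)-neighbours of a
-- vertex x ∈ V lie in V̄, so the union of neighbourhoods of S ⊆ V is
-- represented as a subset of V̄ ≅ Fin n.

Graph : ℕ → Set
Graph n = Fin n → Fin n → Bool

DAdj : ∀ {n} → Graph n → Fin n → Fin n → Bool
DAdj A x y = (x == y) ∨ A x y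

DNbrs : ∀ {n} → Graph n → Subset n → Subset n
DNbrs A S = tabulate (λ y → anyF (λ x → lookup S x ∧ DAdj A x y))

Draconian : ∀ {n} → Graph n → (Fin n → ℕ) → Set
Draconian {n} A c =
  (sumF c ≡ n ∸ 1) ×
  (∀ (S : Subset n) → Nonempty S → sumOver S c < ∣ DNbrs A S ∣)

Edge : ℕ → Set
Edge N = Fin N × Fin N

IsMatching : ∀ {N M} → (Fin M → Edge N) → Set
IsMatching {N} {M} m =
  (∀ k → proj₁ (m k) ≢ proj₂ (m k)) ×
  (∀ k l → k ≢ l → ∀ (x : Fin N) →
     ¬ ((x ≡ proj₁ (m k) ⊎ x ≡ proj₂ (m k)) ×
        (x ≡ proj₁ (m l) ⊎ x ≡ proj₂ (m l))))

-- K_N △ m.  Vertex set Fin (M + N): the first M vertices are the new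
-- vertices w_{m k} (k : Fin M), the remaining N are the vertices of K_N
-- (vertex i of K_N is  M ↑ʳ i).
KTri : ∀ N M → (Fin M → Edge N) → Graph (M + N)
KTri N M m a b with splitAt M a | splitAt M b
... | inj₂ i | inj₂ j = not (i == j)
... | inj₁ k | inj₂ j = (j == proj₁ (m k)) ∨ (j == proj₂ (m k))
... | inj₂ i | inj₁ k = (i == proj₁ (m k)) ∨ (i == proj₂ (m k))
... | inj₁ k | inj₁ l = false

𝐞 : ∀ {n} → Fin n → Fin n → ℕ
𝐞 x y = if x == y then 1 else 0

-- For H' = K_N △ (e ∷ m), the vertex set is Fin (suc (M + N)),
-- vertex zero is w_e and suc a corresponds to vertex a of H.
α : ∀ {n} → (Fin n → ℕ) → Fin (suc n) → ℕ
α c zero    = 1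
α c (suc a) = c a

module _ (N M : ℕ) (m : Fin M → Edge N) (u v : Fin N) where

  H : Graph (M + N)
  H = KTri N M m

  H' : Graph (suc (M + N))
  H' = KTri N (suc M) ((u , v) ∷ m)

  wₑ : Fin (suc (M + N))
  wₑ = zero

  u' v' : Fin (suc (M + N))
  u' = (suc M) ↑ʳ u
  v' = (suc M) ↑ʳ v

  β : (Fin (M + N) → ℕ) → Fin (suc (M + N)) → ℕ
  β c y = (α c y + 𝐞 u' y) ∸ 𝐞 wₑ y

  In𝓑 : (Fin (suc (M + N)) → ℕ) → Set
  In𝓑 f = ∃ λ c → Draconian H c × (β c ≗ f)

  γ₁ : (Fin (M + N) → ℕ) → Fin (suc (M + N)) → ℕ
  γ₁ c y = (α c y + 𝐞 v' y) ∸ 𝐞 wₑ y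

  γ₂ : (Fin (M + N) → ℕ) → Fin (suc (M + N)) → ℕ
  γ₂ c y = (α c y ∸ 𝐞 u' y) + 𝐞 wₑ y

  -- "g = γ(c)" (γ is defined by a case distinction on a proposition,
  -- so we state it as a relation)
  IsGamma : (Fin (M + N) → ℕ) → (Fin (suc (M + N)) → ℕ) → Set
  IsGamma c g = (¬ In𝓑 (γ₁ c) × (g ≗ γ₁ c)) ⊎ (In𝓑 (γ₁ c) × (g ≗ γ₂ c))

-- In D(H′) the new vertex w = w_e sees w̄, ū and v̄, and w̄ is seen by w, u and v.  In the
-- first case γ(c) = α(c) + e_v − e_w vanishes at w, and the extra unit at v in a set S is
-- paid for by w̄, which lies in N(S) as soon as v ∈ S.  In the second case
-- α(c) + e_v − e_w = β(c′) for a draconian c′ = c + e_v − e_u, so c_u ≥ 1 and γ(c) puts 2 on w.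
-- A set S ∋ w gains w̄, ū and v̄ in N(S), which pays for the extra 2 unless some x ∈ S − w
-- already sees ū (and u ∉ S).  As u and v are unmatched, such an x is a vertex of K_N and sees
-- every neighbour of v̄, so Hall's condition for c′ on (S − w) ∪ {v} supplies the missing unit.
-- Finally the value at w (0 or 2) tells the two cases apart, and each case determines c.

module Submission where

open import Defs
open import Data.Bool using (Bool; true; false; if_then_else_; _∧_; _∨_)
open import Data.Bool.Properties using (∨-zeroʳ; ∧-conicalˡ; ∧-conicalʳ; if-eta; if-cong; if-cong-then)
open import Data.Fin using (Fin; zero; suc; _≟_; splitAt; _↑ˡ_; _↑ʳ_)
open import Data.Fin.Properties
  using (nonZeroIndex; suc-injective; splitAt-↑ˡ; splitAt-↑ʳ; splitAt⁻¹-↑ˡ; splitAt⁻¹-↑ʳ; ↑ʳ-injective)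
open import Function using (_∘_)
open import Data.Fin.Subset using (Subset; Nonempty; ⊥; ∣_∣)
open import Data.Fin.Subset.Properties using (nonempty?; Empty-unique)
open import Data.Nat using (>-nonZero⁻¹; ℕ; zero; suc; _+_; _∸_; _<_; _≤_; z≤n; s≤s)
open import Data.Nat.Properties
  using ( +-identityʳ; +-comm; +-mono-≤; +-cancelʳ-≡; ≤-refl; <⇒≤; n<1+n; m≤m+n; m≤n+m; m∸n+n≡m
        ; module ≤-Reasoning; +-commutativeSemigroup)
open import Algebra.Properties.CommutativeSemigroup +-commutativeSemigroup using (interchange)
open import Data.Product using (_×_; _,_; proj₁; proj₂; ∃)
open import Data.Sum using (_⊎_; inj₁; inj₂)
open import Data.Vec using (tabulate; lookup; here; there; _[_]≔_) renaming (_∷_ to _∷ᵥ_)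
open import Data.Vec.Functional using (_∷_)
open import Data.Vec.Properties using (lookup⇒[]=; lookup-replicate; lookup∘update; lookup∘update′)
open import Relation.Nullary using (¬_; yes; no; contradiction)
open import Relation.Nullary.Decidable using (isYes≗does; dec-true; dec-false; ⌊⌋-map′)
open import Relation.Binary.PropositionalEquality

private
  variable
    n : ℕ

==-refl : (x : Fin n) → (x == x) ≡ true
==-refl x = trans (isYes≗does (x ≟ x)) (dec-true (x ≟ x) refl)

==-≢ : {x y : Fin n} → x ≢ y → (x == y) ≡ false
==-≢ {x = x} {y} x≢y = trans (isYes≗does (x ≟ y)) (dec-false (x ≟ y) x≢y)

==⇒≡ : {x y : Fin n} → (x == y) ≡ true → x ≡ y
==⇒≡ {x = x} {y} eq with x ≟ y
... | yes x≡y = x≡y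

==-suc : (x y : Fin n) → (suc x == suc y) ≡ (x == y)
==-suc x y = ⌊⌋-map′ (cong suc) suc-injective (x ≟ y)

∨-≡true : ∀ {a b} → (a ∨ b) ≡ true → a ≡ true ⊎ b ≡ true
∨-≡true {true}  _  = inj₁ refl
∨-≡true {false} eq = inj₂ eq

true≢false : true ≢ false
true≢false ()

indicator : Bool → ℕ
indicator b = if b then 1 else 0

𝐞-suc : (a y : Fin n) → 𝐞 (suc a) (suc y) ≡ 𝐞 a y
𝐞-suc a y = if-cong (==-suc a y)

sumF-cong : {f g : Fin n → ℕ} → f ≗ g → sumF f ≡ sumF g
sumF-cong {zero}  f≗g = refl
sumF-cong {suc n} f≗g = cong₂ _+_ (f≗g zero) (sumF-cong (f≗g ∘ suc))

sumF-mono-≤ : {f g : Fin n → ℕ} → (∀ x → f x ≤ g x) → sumF f ≤ sumF g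
sumF-mono-≤ {zero}  f≤g = z≤n
sumF-mono-≤ {suc n} f≤g = +-mono-≤ (f≤g zero) (sumF-mono-≤ (λ x → f≤g (suc x)))

sumF-distrib-+ : (f g : Fin n → ℕ) → sumF (λ x → f x + g x) ≡ sumF f + sumF g
sumF-distrib-+ {zero}  f g = refl
sumF-distrib-+ {suc n} f g =
  trans (cong (f zero + g zero +_) (sumF-distrib-+ (λ x → f (suc x)) (λ x → g (suc x))))
        (interchange (f zero) (g zero) _ _)

sumF-≗0 : {f : Fin n → ℕ} → (∀ x → f x ≡ 0) → sumF f ≡ 0
sumF-≗0 {zero}  f≗0 = refl
sumF-≗0 {suc n} f≗0 = cong₂ _+_ (f≗0 zero) (sumF-≗0 (λ x → f≗0 (suc x)))

sumF-single : (a : Fin n) {f : Fin n → ℕ} → (∀ x → a ≢ x → f x ≡ 0) → sumF f ≡ f a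
sumF-single zero    {f} off = trans (cong (f zero +_) (sumF-≗0 (λ x → off (suc x) λ ()))) (+-identityʳ _)
sumF-single (suc a) {f} off =
  cong₂ _+_ (off zero λ ()) (sumF-single a (λ x a≢x → off (suc x) (a≢x ∘ suc-injective)))

sumF-𝐞 : (a : Fin n) → sumF (𝐞 a) ≡ 1
sumF-𝐞 a = trans (sumF-single a (λ x a≢x → if-cong (==-≢ a≢x))) (if-cong (==-refl a))

sumF-+𝐞 : (f : Fin n → ℕ) (a : Fin n) → sumF (λ y → f y + 𝐞 a y) ≡ sumF f + 1
sumF-+𝐞 f a = trans (sumF-distrib-+ f (𝐞 a)) (cong (sumF f +_) (sumF-𝐞 a))

∸𝐞+𝐞 : {c : Fin n → ℕ} (a : Fin n) → 1 ≤ c a → ∀ y → (c y ∸ 𝐞 a y) + 𝐞 a y ≡ c y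
∸𝐞+𝐞 a 1≤ca y with a ≟ y
... | yes refl = m∸n+n≡m 1≤ca
... | no  _    = +-identityʳ _

sumF-∸𝐞 : {c : Fin n → ℕ} (a : Fin n) → 1 ≤ c a → sumF (λ y → c y ∸ 𝐞 a y) + 1 ≡ sumF c
sumF-∸𝐞 {c = c} a 1≤ca = trans (sym (sumF-+𝐞 (λ y → c y ∸ 𝐞 a y) a)) (sumF-cong (∸𝐞+𝐞 a 1≤ca))

∸𝐞-injective : {c c′ : Fin n → ℕ} (a : Fin n) → 1 ≤ c a → 1 ≤ c′ a →
  (∀ y → c y ∸ 𝐞 a y ≡ c′ y ∸ 𝐞 a y) → c ≗ c′
∸𝐞-injective {c = c} {c′} a 1≤ca 1≤c′a eq y = begin
  c y                      ≡⟨ ∸𝐞+𝐞 a 1≤ca y ⟨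
  (c y ∸ 𝐞 a y) + 𝐞 a y    ≡⟨ cong (_+ 𝐞 a y) (eq y) ⟩
  (c′ y ∸ 𝐞 a y) + 𝐞 a y   ≡⟨ ∸𝐞+𝐞 a 1≤c′a y ⟩
  c′ y                     ∎
  where open ≡-Reasoning

exchange⇒pos : {c c′ : Fin n → ℕ} {a b : Fin n} → a ≢ b →
  (∀ y → c′ y + 𝐞 a y ≡ c y + 𝐞 b y) → 1 ≤ c a
exchange⇒pos {c = c} {c′} {a} {b} a≢b exchange = begin
  1             ≤⟨ m≤n+m 1 (c′ a) ⟩
  c′ a + 1      ≡⟨ cong (c′ a +_) (if-cong (sym (==-refl a))) ⟩
  c′ a + 𝐞 a a ≡⟨ exchange a ⟩
  c a + 𝐞 b a  ≡⟨ cong (c a +_) (if-cong (==-≢ (a≢b ∘ sym))) ⟩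
  c a + 0       ≡⟨ +-identityʳ (c a) ⟩
  c a           ∎
  where open ≤-Reasoning

pred+1 : Fin n → (n ∸ 1) + 1 ≡ n
pred+1 {n} x = m∸n+n≡m (>-nonZero⁻¹ n {{nonZeroIndex x}})

sumOver-cong : (T : Subset n) {f g : Fin n → ℕ} → f ≗ g → sumOver T f ≡ sumOver T g
sumOver-cong T f≗g = sumF-cong (λ x → if-cong-then (lookup T x) (f≗g x))

sumOver-⊆ : {T T′ : Subset n} (f : Fin n → ℕ) →
  (∀ x → lookup T x ≡ true → lookup T′ x ≡ true) → sumOver T f ≤ sumOver T′ f
sumOver-⊆ {T = T} {T′} f T⊆T′ = sumF-mono-≤ pointwise
  where
  pointwise : ∀ x → (if lookup T x then f x else 0) ≤ (if lookup T′ x then f x else 0)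
  pointwise x with lookup T x | T⊆T′ x
  ... | false | _       = z≤n
  ... | true  | x∈T⇒x∈T′ rewrite x∈T⇒x∈T′ refl = ≤-refl

sumOver-⊥ : (f : Fin n → ℕ) → sumOver ⊥ f ≡ 0
sumOver-⊥ f = sumF-≗0 (λ x → if-cong {x = f x} (lookup-replicate x false))

sumOver-+𝐞 : (T : Subset n) (f : Fin n → ℕ) (a : Fin n) →
  sumOver T (λ y → f y + 𝐞 a y) ≡ sumOver T f + indicator (lookup T a)
sumOver-+𝐞 T f a =
  trans (sumF-cong split)
        (trans (sumF-distrib-+ (λ x → if lookup T x then f x else 0) _) (cong (sumOver T f +_) single))
  where
  split : ∀ x → (if lookup T x then f x + 𝐞 a x else 0)
              ≡ (if lookup T x then f x else 0) + (if lookup T x then 𝐞 a x else 0)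
  split x with lookup T x
  ... | true  = refl
  ... | false = refl
  single : sumF (λ x → if lookup T x then 𝐞 a x else 0) ≡ indicator (lookup T a)
  single = trans (sumF-single a (λ x a≢x → trans (if-cong-then (lookup T x) (if-cong (==-≢ a≢x))) (if-eta _)))
                 (if-cong-then (lookup T a) (if-cong (==-refl a)))

sumOver-∸𝐞 : (T : Subset n) {c : Fin n → ℕ} (a : Fin n) → 1 ≤ c a →
  sumOver T (λ y → c y ∸ 𝐞 a y) + indicator (lookup T a) ≡ sumOver T c
sumOver-∸𝐞 T {c} a 1≤ca = trans (sym (sumOver-+𝐞 T (λ y → c y ∸ 𝐞 a y) a)) (sumOver-cong T (∸𝐞+𝐞 a 1≤ca))

sumOver-∸𝐞-≤ : (T : Subset n) {c : Fin n → ℕ} (a : Fin n) → 1 ≤ c a →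
  sumOver T (λ y → c y ∸ 𝐞 a y) ≤ sumOver T c
sumOver-∸𝐞-≤ T {c} a 1≤ca = subst (sumOver T (λ y → c y ∸ 𝐞 a y) ≤_) (sumOver-∸𝐞 T a 1≤ca) (m≤m+n _ _)

∈-update : (T : Subset n) {a y : Fin n} → lookup T y ≡ true → lookup (T [ a ]≔ true) y ≡ true
∈-update T {a} {y} y∈T with y ≟ a
... | yes refl = lookup∘update y T true
... | no  y≢a  = trans (lookup∘update′ y≢a T true) y∈T

count : (Fin n → Bool) → ℕ
count f = sumF (λ y → indicator (f y))

∣tabulate∣≡count : (f : Fin n → Bool) → ∣ tabulate f ∣ ≡ count f
∣tabulate∣≡count {zero}  f = refl
∣tabulate∣≡count {suc n} f with f zero
... | true  = cong suc (∣tabulate∣≡count (λ x → f (suc x)))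
... | false = ∣tabulate∣≡count (λ x → f (suc x))

count-mono : {f g : Fin n → Bool} → (∀ x → f x ≡ true → g x ≡ true) → count f ≤ count g
count-mono {f = f} {g} f⇒g = sumF-mono-≤ pointwise
  where
  pointwise : ∀ x → indicator (f x) ≤ indicator (g x)
  pointwise x with f x | f⇒g x
  ... | false | _     = z≤n
  ... | true  | fx⇒gx rewrite fx⇒gx refl = ≤-refl

count-insert : (f : Fin n → Bool) (a : Fin n) → f a ≡ false →
  count (λ y → f y ∨ (a == y)) ≡ suc (count f)
count-insert f a fa≡false =
  trans (sumF-cong disjoint) (trans (sumF-+𝐞 (λ y → indicator (f y)) a) (+-comm _ 1))
  where
  disjoint : ∀ y → indicator (f y ∨ (a == y)) ≡ indicator (f y) + 𝐞 a y
  disjoint y with a ≟ y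
  ... | yes refl rewrite fa≡false = refl
  ... | no  _ with f y
  ...   | true  = refl
  ...   | false = refl

-- Neighbourhoods and Hall's condition for a bipartite graph V ⊔ V̄

Bipartite : ℕ → Set
Bipartite n = Fin n → Fin n → Bool

nbrs : Bipartite n → Subset n → Fin n → Bool
nbrs B T y = anyF (λ x → lookup T x ∧ B x y)

anyF-intro : (f : Fin n → Bool) (x : Fin n) → f x ≡ true → anyF f ≡ true
anyF-intro f zero    fx = cong (_∨ anyF (f ∘ suc)) fx
anyF-intro f (suc x) fx = trans (cong (f zero ∨_) (anyF-intro (f ∘ suc) x fx)) (∨-zeroʳ _)

anyF-elim : (f : Fin n → Bool) → anyF f ≡ true → ∃ λ x → f x ≡ true
anyF-elim {suc n} f any with f zero in f0
... | true  = zero , f0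
... | false with anyF-elim (f ∘ suc) any
...   | x , fx = suc x , fx

anyF-cong : {f g : Fin n → Bool} → f ≗ g → anyF f ≡ anyF g
anyF-cong {zero}  f≗g = refl
anyF-cong {suc n} f≗g = cong₂ _∨_ (f≗g zero) (anyF-cong (f≗g ∘ suc))

nbrs-intro : (B : Bipartite n) (T : Subset n) {x y : Fin n} →
  lookup T x ≡ true → B x y ≡ true → nbrs B T y ≡ true
nbrs-intro B T {x} {y} x∈T xy = anyF-intro (λ x′ → lookup T x′ ∧ B x′ y) x (cong₂ _∧_ x∈T xy)

nbrs-elim : (B : Bipartite n) (T : Subset n) {y : Fin n} →
  nbrs B T y ≡ true → ∃ λ x → lookup T x ≡ true × B x y ≡ true
nbrs-elim B T {y} y∈N with anyF-elim (λ x → lookup T x ∧ B x y) y∈N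
... | x , eq = x , ∧-conicalˡ _ _ eq , ∧-conicalʳ _ _ eq

Hall : Bipartite n → (Fin n → ℕ) → Set
Hall {n} B c = ∀ (S : Subset n) → Nonempty S → sumOver S c < count (nbrs B S)

∷-nonempty : ∀ {b} {T : Subset n} → Nonempty (b ∷ᵥ T) → b ≡ true ⊎ Nonempty T
∷-nonempty (zero  , here)    = inj₁ refl
∷-nonempty (suc x , there p) = inj₂ (x , p)

hall-≤ : {B : Bipartite n} {c : Fin n → ℕ} → Hall B c → ∀ T → sumOver T c ≤ count (nbrs B T)
hall-≤ {c = c} hall T with nonempty? T
... | yes T≢∅ = <⇒≤ (hall T T≢∅)
... | no  T≡∅ rewrite Empty-unique T≡∅ | sumOver-⊥ c = z≤n

draconian⇒hall : {A : Graph n} {c : Fin n → ℕ} → Draconian A c → Hall (DAdj A) c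
draconian⇒hall {A = A} {c} (_ , hall) S S≢∅ =
  subst (sumOver S c <_) (∣tabulate∣≡count (nbrs (DAdj A) S)) (hall S S≢∅)

hall⇒draconian : {A : Graph n} {c : Fin n → ℕ} → sumF c ≡ n ∸ 1 → Hall (DAdj A) c → Draconian A c
hall⇒draconian {A = A} {c} sum hall =
  sum , λ S S≢∅ → subst (sumOver S c <_) (sym (∣tabulate∣≡count (nbrs (DAdj A) S))) (hall S S≢∅)

draconian-resp-≗ : {A : Graph n} {c c′ : Fin n → ℕ} → c ≗ c′ → Draconian A c → Draconian A c′
draconian-resp-≗ c≗c′ (sum , hall) =
  trans (sym (sumF-cong c≗c′)) sum , λ S S≢∅ → subst (_< _) (sumOver-cong S c≗c′) (hall S S≢∅)

-- Extending a graph by a vertex w with w̄ ∈ N(v) and ū, v̄ ∈ N(w)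

module OneVertexExtension
  {n : ℕ} (A : Graph n) (A′ : Graph (suc n)) (U V : Fin n) (U≢V : U ≢ V)
  (restrict : ∀ x y → DAdj A′ (suc x) (suc y) ≡ DAdj A x y)
  (w-U : DAdj A′ zero (suc U) ≡ true)
  (w-V : DAdj A′ zero (suc V) ≡ true)
  (V-w : DAdj A′ (suc V) zero ≡ true)
  (nbrV⇒nbrU : ∀ x → DAdj A x V ≡ true → DAdj A x U ≡ true)
  (nbrU⇒⊇nbrsV : ∀ x → DAdj A x U ≡ true → ∀ y → DAdj A V y ≡ true → DAdj A x y ≡ true)
  where

  -- In A′ vertex zero is the new vertex w and suc x is x.

  private
    B : Bipartite n
    B = DAdj A
    B′ : Bipartite (suc n)
    B′ = DAdj A′

  -- For S = b ∷ T (b says whether w ∈ S), N(S) splits into w̄ and a part inside V̄.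

  sees-w̄ : Bool → Subset n → Bool
  sees-w̄ b T = (b ∧ B′ zero zero) ∨ anyF (λ x → lookup T x ∧ B′ (suc x) zero)

  old-nbrs′ : Bool → Subset n → Fin n → Bool
  old-nbrs′ b T y = (b ∧ B′ zero (suc y)) ∨ nbrs B T y

  count-nbrs′ : ∀ b T → count (nbrs B′ (b ∷ᵥ T)) ≡ indicator (sees-w̄ b T) + count (old-nbrs′ b T)
  count-nbrs′ b T = cong (indicator (sees-w̄ b T) +_) (sumF-cong λ y →
    cong (λ z → indicator ((b ∧ B′ zero (suc y)) ∨ z)) (anyF-cong λ x → cong (lookup T x ∧_) (restrict x y)))

  count-nbrs′-seen : ∀ {b T} → sees-w̄ b T ≡ true → count (nbrs B′ (b ∷ᵥ T)) ≡ suc (count (old-nbrs′ b T))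
  count-nbrs′-seen {b} {T} seen =
    trans (count-nbrs′ b T) (cong (λ z → indicator z + count (old-nbrs′ b T)) seen)

  sees-w̄-V : ∀ {b T} → lookup T V ≡ true → sees-w̄ b T ≡ true
  sees-w̄-V {b} {T} V∈T =
    trans (cong (_ ∨_) (anyF-intro (λ x → lookup T x ∧ B′ (suc x) zero) V (cong₂ _∧_ V∈T V-w))) (∨-zeroʳ _)

  nbrs≤old-nbrs′ : ∀ b T → count (nbrs B T) ≤ count (old-nbrs′ b T)
  nbrs≤old-nbrs′ b T = count-mono (λ y y∈N → trans (cong ((b ∧ B′ zero (suc y)) ∨_) y∈N) (∨-zeroʳ _))

  nbrs≤nbrs′ : ∀ b T → count (nbrs B T) ≤ count (nbrs B′ (b ∷ᵥ T))
  nbrs≤nbrs′ b T = begin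
    count (nbrs B T)                                   ≤⟨ nbrs≤old-nbrs′ b T ⟩
    count (old-nbrs′ b T)                              ≤⟨ m≤n+m _ _ ⟩
    indicator (sees-w̄ b T) + count (old-nbrs′ b T)     ≡⟨ count-nbrs′ b T ⟨
    count (nbrs B′ (b ∷ᵥ T))                           ∎
    where open ≤-Reasoning

  hall-extend-V : ∀ {c} → Hall B c → Hall B′ (0 ∷ λ y → c y + 𝐞 V y)
  hall-extend-V {c} hall (b ∷ᵥ T) S≢∅ =
    subst (_< count (nbrs B′ (b ∷ᵥ T))) (sym lhs) bound
    where
    open ≤-Reasoning
    lhs : sumOver (b ∷ᵥ T) (0 ∷ λ y → c y + 𝐞 V y) ≡ sumOver T c + indicator (lookup T V)
    lhs = trans (cong (_+ sumOver T (λ y → c y + 𝐞 V y)) (if-eta b)) (sumOver-+𝐞 T c V)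
    bound : sumOver T c + indicator (lookup T V) < count (nbrs B′ (b ∷ᵥ T))
    bound with lookup T V in V∈T
    ... | true = begin-strict
      sumOver T c + 1              ≡⟨ +-comm _ 1 ⟩
      suc (sumOver T c)            ≤⟨ hall T (V , lookup⇒[]= V T V∈T) ⟩
      count (nbrs B T)             ≤⟨ nbrs≤old-nbrs′ b T ⟩
      count (old-nbrs′ b T)        <⟨ n<1+n _ ⟩
      suc (count (old-nbrs′ b T))  ≡⟨ count-nbrs′-seen {b} {T} (sees-w̄-V {b} {T} V∈T) ⟨
      count (nbrs B′ (b ∷ᵥ T))     ∎
    ... | false with ∷-nonempty S≢∅
    ...   | inj₁ refl = begin-strict
      sumOver T c + 0                 ≡⟨ +-identityʳ _ ⟩
      sumOver T c                     ≤⟨ hall-≤ {B = B} hall T ⟩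
      count (nbrs B T)                ≤⟨ nbrs≤old-nbrs′ true T ⟩
      count (old-nbrs′ true T)        <⟨ n<1+n _ ⟩
      suc (count (old-nbrs′ true T))  ≡⟨ count-nbrs′-seen {true} {T} refl ⟨
      count (nbrs B′ (true ∷ᵥ T))     ∎
    ...   | inj₂ T≢∅ = begin-strict
      sumOver T c + 0             ≡⟨ +-identityʳ _ ⟩
      sumOver T c                 <⟨ hall T T≢∅ ⟩
      count (nbrs B T)            ≤⟨ nbrs≤nbrs′ b T ⟩
      count (nbrs B′ (b ∷ᵥ T))    ∎

  nbrs-V⇒U : ∀ T → nbrs B T V ≡ true → nbrs B T U ≡ true
  nbrs-V⇒U T V∈N with nbrs-elim B T V∈N
  ... | x , x∈T , xV = nbrs-intro B T x∈T (nbrV⇒nbrU x xV)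

  old-nbrs′-gains-U-V : ∀ T → nbrs B T U ≡ false → suc (suc (count (nbrs B T))) ≤ count (old-nbrs′ true T)
  old-nbrs′-gains-U-V T U∉N = begin
    suc (suc (count (nbrs B T)))                          ≡⟨ cong suc (count-insert (nbrs B T) U U∉N) ⟨
    suc (count (λ y → nbrs B T y ∨ (U == y)))              ≡⟨ count-insert (λ y → nbrs B T y ∨ (U == y)) V V∉N∪U ⟨
    count (λ y → (nbrs B T y ∨ (U == y)) ∨ (V == y))       ≤⟨ count-mono ⊆old-nbrs′ ⟩
    count (old-nbrs′ true T)                              ∎
    where
    open ≤-Reasoning
    V∉N : nbrs B T V ≡ false
    V∉N with nbrs B T V in V∈N
    ... | false = refl
    ... | true  = contradiction (trans (sym (nbrs-V⇒U T V∈N)) U∉N) true≢false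
    V∉N∪U : (nbrs B T V ∨ (U == V)) ≡ false
    V∉N∪U = cong₂ _∨_ V∉N (==-≢ U≢V)
    ⊆old-nbrs′ : ∀ y → ((nbrs B T y ∨ (U == y)) ∨ (V == y)) ≡ true → old-nbrs′ true T y ≡ true
    ⊆old-nbrs′ y y∈ with ∨-≡true {nbrs B T y ∨ (U == y)} y∈
    ... | inj₂ V≡y rewrite ==⇒≡ V≡y = cong (_∨ _) w-V
    ... | inj₁ y∈N∪U with ∨-≡true {nbrs B T y} y∈N∪U
    ...   | inj₂ U≡y rewrite ==⇒≡ U≡y = cong (_∨ _) w-U
    ...   | inj₁ y∈N = trans (cong (_ ∨_) y∈N) (∨-zeroʳ _)

  nbrs-insertV⊆nbrs : ∀ T {x} → lookup T x ≡ true → B x U ≡ true →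
    ∀ y → nbrs B (T [ V ]≔ true) y ≡ true → nbrs B T y ≡ true
  nbrs-insertV⊆nbrs T x∈T xU y y∈N⁺ with nbrs-elim B (T [ V ]≔ true) y∈N⁺
  ... | z , z∈T⁺ , zy with z ≟ V
  ...   | yes refl = nbrs-intro B T x∈T (nbrU⇒⊇nbrsV _ xU y zy)
  ...   | no  z≢V  = nbrs-intro B T (trans (sym (lookup∘update′ z≢V T true)) z∈T⁺) zy

  module _ {c c′ : Fin n → ℕ} (hall : Hall B c) (hall′ : Hall B c′)
           (exchange : ∀ y → c′ y + 𝐞 U y ≡ c y + 𝐞 V y) where

    -- Hall's condition for c′ on T ∪ {v}, whose neighbourhood is that of T.

    exchange-step : ∀ T {x} → lookup T x ≡ true → B x U ≡ true → lookup T U ≡ false →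
      suc (sumOver T c) < count (nbrs B T)
    exchange-step T x∈T xU U∉T = begin-strict
      suc (sumOver T c)                         ≤⟨ s≤s (sumOver-⊆ {T = T} {T⁺} c (λ y → ∈-update T)) ⟩
      suc (sumOver T⁺ c)                        ≡⟨ +-comm 1 _ ⟩
      sumOver T⁺ c + indicator true             ≡⟨ cong (λ b → sumOver T⁺ c + indicator b) V∈T⁺ ⟨
      sumOver T⁺ c + indicator (lookup T⁺ V)    ≡⟨ sumOver-+𝐞 T⁺ c V ⟨
      sumOver T⁺ (λ y → c y + 𝐞 V y)            ≡⟨ sumOver-cong T⁺ exchange ⟨
      sumOver T⁺ (λ y → c′ y + 𝐞 U y)           ≡⟨ sumOver-+𝐞 T⁺ c′ U ⟩
      sumOver T⁺ c′ + indicator (lookup T⁺ U)   ≡⟨ cong (λ b → sumOver T⁺ c′ + indicator b) U∉T⁺ ⟩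
      sumOver T⁺ c′ + 0                         ≡⟨ +-identityʳ _ ⟩
      sumOver T⁺ c′                             <⟨ hall′ T⁺ (V , lookup⇒[]= V T⁺ V∈T⁺) ⟩
      count (nbrs B T⁺)                         ≤⟨ count-mono (nbrs-insertV⊆nbrs T x∈T xU) ⟩
      count (nbrs B T)                          ∎
      where
      open ≤-Reasoning
      T⁺ : Subset n
      T⁺ = T [ V ]≔ true
      V∈T⁺ : lookup T⁺ V ≡ true
      V∈T⁺ = lookup∘update V T true
      U∉T⁺ : lookup T⁺ U ≡ false
      U∉T⁺ = trans (lookup∘update′ U≢V T true) U∉T

    private
      d : Fin n → ℕ
      d y = c y ∸ 𝐞 U y

      1≤cU : 1 ≤ c U
      1≤cU = exchange⇒pos U≢V exchange

    old-nbrs′-bound : ∀ T → suc (sumOver T d) < count (old-nbrs′ true T)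
    old-nbrs′-bound T with nbrs B T U in U∈N
    ... | false = begin-strict
      suc (sumOver T d)              ≤⟨ s≤s (sumOver-∸𝐞-≤ T U 1≤cU) ⟩
      suc (sumOver T c)              ≤⟨ s≤s (hall-≤ {B = B} hall T) ⟩
      suc (count (nbrs B T))         <⟨ old-nbrs′-gains-U-V T U∈N ⟩
      count (old-nbrs′ true T)       ∎
      where open ≤-Reasoning
    ... | true with nbrs-elim B T U∈N | lookup T U in U∈T
    ...   | x , x∈T , xU | true = begin-strict
      suc (sumOver T d)                       ≡⟨ +-comm 1 _ ⟩
      sumOver T d + indicator true            ≡⟨ cong (λ b → sumOver T d + indicator b) U∈T ⟨
      sumOver T d + indicator (lookup T U)    ≡⟨ sumOver-∸𝐞 T U 1≤cU ⟩
      sumOver T c                             <⟨ hall T (U , lookup⇒[]= U T U∈T) ⟩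
      count (nbrs B T)                        ≤⟨ nbrs≤old-nbrs′ true T ⟩
      count (old-nbrs′ true T)                ∎
      where open ≤-Reasoning
    ...   | x , x∈T , xU | false = begin-strict
      suc (sumOver T d)              ≤⟨ s≤s (sumOver-∸𝐞-≤ T U 1≤cU) ⟩
      suc (sumOver T c)              <⟨ exchange-step T x∈T xU U∈T ⟩
      count (nbrs B T)               ≤⟨ nbrs≤old-nbrs′ true T ⟩
      count (old-nbrs′ true T)       ∎
      where open ≤-Reasoning

    hall-extend-exchange : Hall B′ (2 ∷ λ y → c y ∸ 𝐞 U y)
    hall-extend-exchange (true ∷ᵥ T) _ =
      subst (2 + sumOver T d <_) (sym (count-nbrs′-seen {true} {T} refl)) (s≤s (old-nbrs′-bound T))
    hall-extend-exchange (false ∷ᵥ T) S≢∅ with ∷-nonempty S≢∅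
    ... | inj₂ T≢∅ = begin-strict
      sumOver T d                    ≤⟨ sumOver-∸𝐞-≤ T U 1≤cU ⟩
      sumOver T c                    <⟨ hall T T≢∅ ⟩
      count (nbrs B T)               ≤⟨ nbrs≤nbrs′ false T ⟩
      count (nbrs B′ (false ∷ᵥ T))   ∎
      where open ≤-Reasoning

  draconian-extend-V : ∀ {c} → Draconian A c → Draconian A′ (0 ∷ λ y → c y + 𝐞 V y)
  draconian-extend-V {c} dc@(sum , _) =
    hall⇒draconian {A = A′} {0 ∷ λ y → c y + 𝐞 V y}
      (trans (sumF-+𝐞 c V) (trans (cong (_+ 1) sum) (pred+1 V)))
      (hall-extend-V (draconian⇒hall {A = A} dc))

  draconian-extend-exchange : ∀ {c c′} → Draconian A c → Draconian A c′ →
    (∀ y → c′ y + 𝐞 U y ≡ c y + 𝐞 V y) → Draconian A′ (2 ∷ λ y → c y ∸ 𝐞 U y)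
  draconian-extend-exchange {c} {c′} dc@(sum , _) dc′ exchange =
    hall⇒draconian {A = A′} {2 ∷ λ y → c y ∸ 𝐞 U y} sum′
      (hall-extend-exchange (draconian⇒hall {A = A} dc) (draconian⇒hall {A = A} dc′) exchange)
    where
    open ≡-Reasoning
    sum′ : 2 + sumF (λ y → c y ∸ 𝐞 U y) ≡ n
    sum′ = begin
      2 + sumF (λ y → c y ∸ 𝐞 U y)        ≡⟨ cong suc (+-comm 1 _) ⟩
      suc (sumF (λ y → c y ∸ 𝐞 U y) + 1)  ≡⟨ cong suc (sumF-∸𝐞 U (exchange⇒pos U≢V exchange)) ⟩
      suc (sumF c)                        ≡⟨ cong suc sum ⟩
      suc (n ∸ 1)                         ≡⟨ +-comm 1 _ ⟩
      (n ∸ 1) + 1                         ≡⟨ pred+1 U ⟩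
      n                                   ∎

-- The graphs K_N △ m

data Vertex (M N : ℕ) : Fin (M + N) → Set where
  new : (k : Fin M) → Vertex M N (k ↑ˡ N)
  old : (i : Fin N) → Vertex M N (M ↑ʳ i)

vertex : ∀ M {N} (a : Fin (M + N)) → Vertex M N a
vertex M a with splitAt M a in eq
... | inj₁ k = subst (Vertex M _) (splitAt⁻¹-↑ˡ eq) (new k)
... | inj₂ i = subst (Vertex M _) (splitAt⁻¹-↑ʳ eq) (old i)

new≢old : ∀ {M N} (k : Fin M) (i : Fin N) → k ↑ˡ N ≢ M ↑ʳ i
new≢old {M} {N} k i eq
  with () ← trans (sym (splitAt-↑ˡ M k N)) (trans (cong (splitAt M) eq) (splitAt-↑ʳ M N i))

module _ {N M : ℕ} (m : Fin M → Edge N) where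

  Unmatched : Fin N → Set
  Unmatched w = ∀ k → ¬ (w ≡ proj₁ (m k) ⊎ w ≡ proj₂ (m k))

  private
    K : Graph (M + N)
    K = KTri N M m

    unmatched-test : ∀ {w} → Unmatched w → ∀ k → ((w == proj₁ (m k)) ∨ (w == proj₂ (m k))) ≡ false
    unmatched-test un k = cong₂ _∨_ (==-≢ (un k ∘ inj₁)) (==-≢ (un k ∘ inj₂))

  old-adj-old : ∀ i j → DAdj K (M ↑ʳ i) (M ↑ʳ j) ≡ true
  old-adj-old i j with i ≟ j
  ... | yes refl = cong (_∨ K (M ↑ʳ i) (M ↑ʳ i)) (==-refl (M ↑ʳ i))
  ... | no  i≢j rewrite splitAt-↑ʳ M N i | splitAt-↑ʳ M N j | ==-≢ i≢j = ∨-zeroʳ _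

  nbr-unmatchedˡ : ∀ {w} → Unmatched w → ∀ {a} → DAdj K a (M ↑ʳ w) ≡ true → ∃ λ i → a ≡ M ↑ʳ i
  nbr-unmatchedˡ {w} un {a} adj with vertex M a
  ... | old i = i , refl
  ... | new k rewrite ==-≢ (new≢old k w) | splitAt-↑ˡ M k N | splitAt-↑ʳ M N w | unmatched-test un k =
    contradiction adj (λ ())

  nbr-unmatchedʳ : ∀ {w} → Unmatched w → ∀ {a} → DAdj K (M ↑ʳ w) a ≡ true → ∃ λ i → a ≡ M ↑ʳ i
  nbr-unmatchedʳ {w} un {a} adj with vertex M a
  ... | old i = i , refl
  ... | new k rewrite ==-≢ (new≢old k w ∘ sym) | splitAt-↑ˡ M k N | splitAt-↑ʳ M N w | unmatched-test un k =
    contradiction adj (λ ())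

module _ (N M : ℕ) (m : Fin M → Edge N) (u v : Fin N) (matching : IsMatching ((u , v) ∷ m)) where

  private
    U V : Fin (M + N)
    U = M ↑ʳ u
    V = M ↑ʳ v

    u-unmatched : Unmatched m u
    u-unmatched k cover = proj₂ matching zero (suc k) (λ ()) u (inj₁ refl , cover)

    v-unmatched : Unmatched m v
    v-unmatched k cover = proj₂ matching zero (suc k) (λ ()) v (inj₂ refl , cover)

    U≢V : U ≢ V
    U≢V = proj₁ matching zero ∘ ↑ʳ-injective M u v

    KTri-suc : ∀ x y → KTri N (suc M) ((u , v) ∷ m) (suc x) (suc y) ≡ KTri N M m x y
    KTri-suc x y with splitAt M x | splitAt M y
    ... | inj₁ _ | inj₁ _ = refl
    ... | inj₁ _ | inj₂ _ = refl
    ... | inj₂ _ | inj₁ _ = refl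
    ... | inj₂ _ | inj₂ _ = refl

    restrict : ∀ x y → DAdj (H' N M m u v) (suc x) (suc y) ≡ DAdj (H N M m u v) x y
    restrict x y = cong₂ _∨_ (==-suc x y) (KTri-suc x y)

    w-U : DAdj (H' N M m u v) zero (suc U) ≡ true
    w-U rewrite splitAt-↑ʳ M N u | ==-refl u = refl

    w-V : DAdj (H' N M m u v) zero (suc V) ≡ true
    w-V rewrite splitAt-↑ʳ M N v | ==-refl v = ∨-zeroʳ _

    V-w : DAdj (H' N M m u v) (suc V) zero ≡ true
    V-w rewrite splitAt-↑ʳ M N v | ==-refl v = ∨-zeroʳ _

    nbrV⇒nbrU : ∀ x → DAdj (H N M m u v) x V ≡ true → DAdj (H N M m u v) x U ≡ true
    nbrV⇒nbrU x xV with nbr-unmatchedˡ m v-unmatched xV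
    ... | i , refl = old-adj-old m i u

    nbrU⇒⊇nbrsV : ∀ x → DAdj (H N M m u v) x U ≡ true →
      ∀ y → DAdj (H N M m u v) V y ≡ true → DAdj (H N M m u v) x y ≡ true
    nbrU⇒⊇nbrsV x xU y Vy with nbr-unmatchedˡ m u-unmatched xU | nbr-unmatchedʳ m v-unmatched Vy
    ... | i , refl | j , refl = old-adj-old m i j

  open OneVertexExtension (H N M m u v) (H' N M m u v) U V U≢V restrict w-U w-V V-w nbrV⇒nbrU nbrU⇒⊇nbrsV

  γ₁-≗ : (c : Fin (M + N) → ℕ) → γ₁ N M m u v c ≗ (0 ∷ λ y → c y + 𝐞 V y)
  γ₁-≗ c zero    = refl
  γ₁-≗ c (suc y) = cong (c y +_) (𝐞-suc V y)

  γ₂-≗ : (c : Fin (M + N) → ℕ) → γ₂ N M m u v c ≗ (2 ∷ λ y → c y ∸ 𝐞 U y)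
  γ₂-≗ c zero    = refl
  γ₂-≗ c (suc y) = trans (+-identityʳ _) (cong (c y ∸_) (𝐞-suc U y))

  β≗γ₁⇒exchange : ∀ {c c′} → β N M m u v c′ ≗ γ₁ N M m u v c → ∀ y → c′ y + 𝐞 U y ≡ c y + 𝐞 V y
  β≗γ₁⇒exchange {c} {c′} eq y =
    trans (cong (c′ y +_) (sym (𝐞-suc U y))) (trans (eq (suc y)) (γ₁-≗ c (suc y)))

  γ-draconian : ∀ c → Draconian (H N M m u v) c →
    ∀ g → IsGamma N M m u v c g → Draconian (H' N M m u v) g
  γ-draconian c dc g (inj₁ (_ , g≗γ₁)) =
    draconian-resp-≗ {A = H' N M m u v} (λ y → sym (trans (g≗γ₁ y) (γ₁-≗ c y))) (draconian-extend-V dc)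
  γ-draconian c dc g (inj₂ ((c′ , dc′ , β≗γ₁) , g≗γ₂)) =
    draconian-resp-≗ {A = H' N M m u v} (λ y → sym (trans (g≗γ₂ y) (γ₂-≗ c y)))
      (draconian-extend-exchange dc dc′ (β≗γ₁⇒exchange β≗γ₁))

  -- γ(c) is 0 at w_e in the first case and 2 in the second.

  γ-injective : ∀ c c′ → ∀ g g′ → IsGamma N M m u v c g → IsGamma N M m u v c′ g′ → g ≗ g′ → c ≗ c′
  γ-injective c c′ g g′ (inj₁ (_ , g≗)) (inj₁ (_ , g′≗)) g≗g′ y =
    +-cancelʳ-≡ _ (c y) (c′ y) (trans (sym (g≗ (suc y))) (trans (g≗g′ (suc y)) (g′≗ (suc y))))
  γ-injective c c′ g g′ (inj₁ (_ , g≗)) (inj₂ (_ , g′≗)) g≗g′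
    with () ← trans (sym (g≗ zero)) (trans (g≗g′ zero) (g′≗ zero))
  γ-injective c c′ g g′ (inj₂ (_ , g≗)) (inj₁ (_ , g′≗)) g≗g′
    with () ← trans (sym (g≗ zero)) (trans (g≗g′ zero) (g′≗ zero))
  γ-injective c c′ g g′ (inj₂ ((_ , _ , β≗) , g≗)) (inj₂ ((_ , _ , β′≗) , g′≗)) g≗g′ =
    ∸𝐞-injective U (exchange⇒pos U≢V (β≗γ₁⇒exchange β≗)) (exchange⇒pos U≢V (β≗γ₁⇒exchange β′≗))
      (λ y → trans (sym (trans (g≗ (suc y)) (γ₂-≗ c (suc y))))
                   (trans (g≗g′ (suc y)) (trans (g′≗ (suc y)) (γ₂-≗ c′ (suc y)))))

lemma2p7 : (N M : ℕ) (m : Fin M → Edge N) (u v : Fin N) →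
    IsMatching m → IsMatching ((u , v) ∷ m) →
    ((c : Fin (M + N) → ℕ) → Draconian (H N M m u v) c →
       (g : Fin (suc (M + N)) → ℕ) → IsGamma N M m u v c g →
       Draconian (H' N M m u v) g)
    ×
    ((c c' : Fin (M + N) → ℕ) → Draconian (H N M m u v) c → Draconian (H N M m u v) c' →
       (g g' : Fin (suc (M + N)) → ℕ) → IsGamma N M m u v c g → IsGamma N M m u v c' g' →
       g ≗ g' → c ≗ c')
-- IsMatching m is implied by IsMatching ((u , v) ∷ m).
lemma2p7 N M m u v _ matching =
  γ-draconian N M m u v matching , λ c c′ _ _ → γ-injective N M m u v matching c c′
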